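{- Let $d\ge 1$, $k\ge 2$, and let $(\mathbb{R}^d,\mathcal{A})$ be a range space (with $\mathcal{A}$ a family of subsets of $\mathbb{R}^d$) of VC-dimension $\nu$. Consider the range space $(\mathbb{R}^{d\times k},\mathcal{A}_k)$ whose ground set consists of $k$-tuples $P=(p_1,\ldots,p_k)$ of points of $\mathbb{R}^d$ (thought of as a set of $k$ points all carrying one label), and whose ranges are, for each $A\in\mathcal{A}$, the set $\{P \in \mathbb{R}^{d\times k} : p_j \in A \text{ for some } j\}$. Then the growth function of $(\mathbb{R}^{d\times k},\mathcal{A}_k)$ on $m$ elements is $m^{O(\nu\log k)}$, and hence its VC-dimension is $O(\nu\log k)$.
   Context: The growth function of a range space evaluated at $m$ is the maximum, over all $m$-element subsets $Y$ of the ground set, of the number of distinct sets $Y\cap R$ as $R$ ranges over the ranges. -}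

module Defs where

open import Data.Nat using (ℕ; zero; suc; _≤_)
open import Data.Fin using (Fin; zero; suc)
open import Data.Bool using (Bool; false; _∨_)
open import Data.Product using (∃; _×_)
open import Relation.Nullary using (¬_)
open import Relation.Binary.PropositionalEquality using (_≡_; _≢_)
open import Function.Definitions using (Injective)

-- A range space (X , 𝒜): ground set X, ranges given as an indexed family
-- A : I → (X → Bool) of (characteristic functions of) subsets of X.

anyFin : (k : ℕ) → (Fin k → Bool) → Bool
anyFin zero    b = false
anyFin (suc k) b = b zero ∨ anyFin k (λ j → b (suc j))

-- An m-element subset Y of X, given as an injective enumeration f : Fin m → X.
-- Two ranges i, j have the same trace on Y.
SameTrace : {X I : Set} → (I → X → Bool) → {m : ℕ} → (Fin m → X) → I → I → Set
SameTrace A f i j = ∀ t → A i (f t) ≡ A j (f t)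

-- Growth function at m is at most N: for every m-element subset Y, every
-- collection of ranges with pairwise distinct traces Y ∩ R has at most N members
-- (i.e. the number of distinct sets Y ∩ R is ≤ N).
GrowthAtMost : {X I : Set} → (I → X → Bool) → ℕ → ℕ → Set
GrowthAtMost {X} {I} A m N =
  (f : Fin m → X) → Injective _≡_ _≡_ f →
  (L : ℕ) (g : Fin L → I) →
  (∀ a b → a ≢ b → ¬ SameTrace A f (g a) (g b)) →
  L ≤ N

Shatters : {X I : Set} → (I → X → Bool) → {n : ℕ} → (Fin n → X) → Set
Shatters {X} {I} A {n} f = (s : Fin n → Bool) → ∃ λ (i : I) → ∀ t → A i (f t) ≡ s t

VCdim : {X I : Set} → (I → X → Bool) → ℕ → Set
VCdim {X} A ν =
  (∃ λ (f : Fin ν → X) → Injective _≡_ _≡_ f × Shatters A f) ×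
  ((f : Fin (suc ν) → X) → Injective _≡_ _≡_ f → ¬ Shatters A f)

VCdimAtMost : {X I : Set} → (I → X → Bool) → ℕ → Set
VCdimAtMost {X} A D =
  (n : ℕ) (f : Fin n → X) → Injective _≡_ _≡_ f → Shatters A f → n ≤ D

Kfold : {X I : Set} → (I → X → Bool) → (k : ℕ) → I → (Fin k → X) → Bool
Kfold A k i P = anyFin k (λ j → A i (P j))

-- The traces of the k-fold ranges on m tuples are determined by the traces of the
-- original ranges on the m k underlying points, so the Sauer–Shelah lemma bounds
-- their number by Φ(m k, ν + 1) ≤ (m k + 1)^ν = m^O(ν log k), with Φ(N, d) the
-- number of subsets of an N-set of size < d.  For the VC-dimension, a shattered set
-- of n tuples gives 2^n ≤ Φ(n k, ν + 1); the weighted estimate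
-- T^N Φ(N, ν + 1) ≤ T^ν (T + 1)^N with T = 4k and N = n k turns this into
-- (3/2)^n ≤ (4k)^ν, whence n ≤ 2 ν log₂(4k) = O(ν log k).
module Submission where

open import Defs
open import Data.Nat using (ℕ; zero; suc; pred; _+_; _*_; _^_; _≤_; _<_; z≤n; s≤s; ⌈_/2⌉; NonZero)
open import Data.Nat.Properties
open import Data.Nat.Logarithm using (⌈log₂_⌉; ⌈log₂⌉-mono-≤)
open import Data.Nat.Logarithm.Core using (⌈log2⌉)
open import Data.Nat.Induction using (<-wellFounded)
open import Data.Nat.Tactic.RingSolver using (solve-∀)
open import Induction.WellFounded using (Acc; acc)
open import Algebra.Properties.CommutativeSemigroup +-commutativeSemigroup
  using () renaming (interchange to +-interchange)
open import Algebra.Properties.CommutativeSemigroup *-commutativeSemigroup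
  using () renaming (interchange to *-interchange)
open import Data.Fin using (Fin; zero; suc; _↑ˡ_; _↑ʳ_; splitAt; lift; remQuot; combine)
import Data.Fin.Properties as Fin
open import Data.Bool using (Bool; true; false; _∨_; _∧_; if_then_else_)
import Data.Bool.Properties as Bool
open import Data.Vec using (Vec; []; _∷_; lookup; tabulate)
import Data.Vec.Properties as Vec
open import Data.Product using (∃; _×_; _,_; proj₁; proj₂; uncurry)
open import Data.Sum using (_⊎_; inj₁; inj₂)
open import Data.Empty using (⊥-elim)
open import Relation.Nullary using (¬_; yes; no; does; contradiction)
open import Relation.Nullary.Decidable using (dec-true; dec-false)
open import Relation.Binary.PropositionalEquality
open import Function using (_∘_)
open import Function.Bundles using (Inverse; Injection)
open import Function.Definitions using (Injective)
open import Function.Properties.Inverse using (↔⇒↣)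

count : ∀ n → (Vec Bool n → Bool) → ℕ
count zero    P = if P [] then 1 else 0
count (suc n) P = count n (P ∘ (false ∷_)) + count n (P ∘ (true ∷_))

index : ∀ n P (v : Vec Bool n) → P v ≡ true → Fin (count n P)
index zero    P []          p rewrite p = zero
index (suc n) P (false ∷ v) p = index n (P ∘ (false ∷_)) v p ↑ˡ _
index (suc n) P (true ∷ v)  p = _ ↑ʳ index n (P ∘ (true ∷_)) v p

↑ˡ≢↑ʳ : ∀ {m n} (i : Fin m) (j : Fin n) → i ↑ˡ n ≢ m ↑ʳ j
↑ˡ≢↑ʳ {m} {n} i j eq
  with () ← trans (sym (Fin.splitAt-↑ˡ m i n)) (trans (cong (splitAt m) eq) (Fin.splitAt-↑ʳ m n j))

index-injective : ∀ n P (v w : Vec Bool n) p q → index n P v p ≡ index n P w q → v ≡ w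
index-injective zero    P []          []          p q eq = refl
index-injective (suc n) P (false ∷ v) (false ∷ w) p q eq =
  cong (false ∷_) (index-injective n _ v w p q (Fin.↑ˡ-injective _ _ _ eq))
index-injective (suc n) P (true ∷ v)  (true ∷ w)  p q eq =
  cong (true ∷_) (index-injective n _ v w p q (Fin.↑ʳ-injective _ _ _ eq))
index-injective (suc n) P (false ∷ v) (true ∷ w)  p q eq = ⊥-elim (↑ˡ≢↑ʳ _ _ eq)
index-injective (suc n) P (true ∷ v)  (false ∷ w) p q eq = ⊥-elim (↑ˡ≢↑ʳ _ _ (sym eq))

injection⇒≤count : ∀ n P {L} (φ : Fin L → Vec Bool n) (sat : ∀ a → P (φ a) ≡ true) →
                   Injective _≡_ _≡_ φ → L ≤ count n P
injection⇒≤count n P φ sat φ-inj =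
  Fin.injective⇒≤ (φ-inj ∘ index-injective n P _ _ (sat _) (sat _))

count-∨+∧ : ∀ n (P Q : Vec Bool n → Bool) →
            count n P + count n Q ≡ count n (λ v → P v ∨ Q v) + count n (λ v → P v ∧ Q v)
count-∨+∧ zero P Q with P [] | Q []
... | true  | true  = refl
... | true  | false = refl
... | false | true  = refl
... | false | false = refl
count-∨+∧ (suc n) P Q = begin
  (c false P + c true P) + (c false Q + c true Q)         ≡⟨ +-interchange (c false P) _ _ _ ⟩
  (c false P + c false Q) + (c true P + c true Q)         ≡⟨ cong₂ _+_ (count-∨+∧ n _ _) (count-∨+∧ n _ _) ⟩
  (c false P∨Q + c false P∧Q) + (c true P∨Q + c true P∧Q) ≡⟨ +-interchange (c false P∨Q) _ _ _ ⟩
  (c false P∨Q + c true P∨Q) + (c false P∧Q + c true P∧Q) ∎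
  where
  open ≡-Reasoning
  c : Bool → (Vec Bool (suc n) → Bool) → ℕ
  c b R = count n (R ∘ (b ∷_))
  P∨Q P∧Q : Vec Bool (suc n) → Bool
  P∨Q v = P v ∨ Q v
  P∧Q v = P v ∧ Q v

count-false : ∀ n (P : Vec Bool n → Bool) → (∀ v → P v ≢ true) → count n P ≡ 0
count-false zero    P never with P [] in eq
... | true  = contradiction eq (never [])
... | false = refl
count-false (suc n) P never =
  cong₂ _+_ (count-false n _ (never ∘ (false ∷_))) (count-false n _ (never ∘ (true ∷_)))

ShattersAt : ∀ {n d} → (Vec Bool n → Bool) → (Fin d → Fin n) → Set
ShattersAt {d = d} P e =
  (s : Fin d → Bool) → ∃ λ v → P v ≡ true × (∀ j → lookup v (e j) ≡ s j)

ShattersNo : ∀ {n} → ℕ → (Vec Bool n → Bool) → Set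
ShattersNo {n} d P = (e : Fin d → Fin n) → Injective _≡_ _≡_ e → ¬ ShattersAt P e

-- Φ n d = Σ_{i < d} (n choose i), via Pascal's rule.
Φ : ℕ → ℕ → ℕ
Φ n       zero    = 0
Φ zero    (suc d) = 1
Φ (suc n) (suc d) = Φ n (suc d) + Φ n d

∨≡true⁻ : ∀ x y → x ∨ y ≡ true → x ≡ true ⊎ y ≡ true
∨≡true⁻ true  y _ = inj₁ refl
∨≡true⁻ false y p = inj₂ p

shattersAt-∨⇒shattersAt-suc : ∀ {n d} (P : Vec Bool (suc n) → Bool) (e : Fin d → Fin n) →
  ShattersAt (λ v → P (false ∷ v) ∨ P (true ∷ v)) e → ShattersAt P (suc ∘ e)
shattersAt-∨⇒shattersAt-suc P e sh s with sh s
... | v , p , agree with ∨≡true⁻ (P (false ∷ v)) _ p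
...   | inj₁ p₀ = false ∷ v , p₀ , agree
...   | inj₂ p₁ = true ∷ v , p₁ , agree

shattersAt-∧⇒shattersAt-lift : ∀ {n d} (P : Vec Bool (suc n) → Bool) (e : Fin d → Fin n) →
  ShattersAt (λ v → P (false ∷ v) ∧ P (true ∷ v)) e → ShattersAt P (lift 1 e)
shattersAt-∧⇒shattersAt-lift P e sh s with sh (s ∘ suc)
... | v , p , agree = s zero ∷ v , both (s zero) (Bool.∧-conicalˡ _ _ p , Bool.∧-conicalʳ _ _ p) , agree′
  where
  both : ∀ b → P (false ∷ v) ≡ true × P (true ∷ v) ≡ true → P (b ∷ v) ≡ true
  both false (p₀ , _) = p₀
  both true  (_ , p₁) = p₁
  agree′ : ∀ j → lookup (s zero ∷ v) (lift 1 e j) ≡ s j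
  agree′ zero    = refl
  agree′ (suc j) = agree j

count≤Φ : ∀ n d (P : Vec Bool n → Bool) → ShattersNo d P → count n P ≤ Φ n d
count≤Φ n zero P noShattered = ≤-reflexive (count-false n P never)
  where
  never : ∀ v → P v ≢ true
  never v p = noShattered (λ ()) (λ { {()} }) (λ _ → v , p , λ ())
count≤Φ zero (suc d) P _ with P []
... | true  = ≤-refl
... | false = z≤n
count≤Φ (suc n) (suc d) P noShattered = begin
  count (suc n) P         ≡⟨ count-∨+∧ n (P ∘ (false ∷_)) (P ∘ (true ∷_)) ⟩
  count n Q + count n R   ≤⟨ +-mono-≤ (count≤Φ n (suc d) Q noShatteredQ) (count≤Φ n d R noShatteredR) ⟩
  Φ n (suc d) + Φ n d     ∎
  where
  open ≤-Reasoning
  Q R : Vec Bool n → Bool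
  Q v = P (false ∷ v) ∨ P (true ∷ v)
  R v = P (false ∷ v) ∧ P (true ∷ v)
  noShatteredQ : ShattersNo (suc d) Q
  noShatteredQ e e-inj sh =
    noShattered (suc ∘ e) (e-inj ∘ Fin.suc-injective) (shattersAt-∨⇒shattersAt-suc P e sh)
  noShatteredR : ShattersNo d R
  noShatteredR e e-inj sh =
    noShattered (lift 1 e) (Fin.lift-injective e e-inj 1) (shattersAt-∧⇒shattersAt-lift P e sh)

DistinctTraces : {X I : Set} → (I → X → Bool) → {m : ℕ} → (Fin m → X) → {L : ℕ} → (Fin L → I) → Set
DistinctTraces A f g = ∀ a b → a ≢ b → ¬ SameTrace A f (g a) (g b)

shatters⇒injective : {X I : Set} (A : I → X → Bool) {n : ℕ} (f : Fin n → X) →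
                     Shatters A f → Injective _≡_ _≡_ f
shatters⇒injective A f sh {i} {j} fi≡fj with i Fin.≟ j
... | yes i≡j = i≡j
... | no  i≢j with sh (λ t → does (t Fin.≟ i))
...   | r , agree = contradiction (begin
  true             ≡⟨ dec-true (i Fin.≟ i) refl ⟨
  does (i Fin.≟ i) ≡⟨ agree i ⟨
  A r (f i)        ≡⟨ cong (A r) fi≡fj ⟩
  A r (f j)        ≡⟨ agree j ⟩
  does (j Fin.≟ i) ≡⟨ dec-false (j Fin.≟ i) (i≢j ∘ sym) ⟩
  false            ∎) λ ()
  where open ≡-Reasoning

bits : ∀ n → Fin (2 ^ n) → Fin n → Bool
bits (suc n) i zero    = Inverse.to Fin.2↔Bool (proj₁ (remQuot {2} (2 ^ n) i))
bits (suc n) i (suc t) = bits n (proj₂ (remQuot {2} (2 ^ n) i)) t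

bits-injective : ∀ n {i j} → (∀ t → bits n i t ≡ bits n j t) → i ≡ j
bits-injective zero    {zero}  {zero}  _    = refl
bits-injective (suc n) {i}     {j}     same = begin
  i                                       ≡⟨ Fin.combine-remQuot {2} (2 ^ n) i ⟨
  uncurry combine (remQuot {2} (2 ^ n) i) ≡⟨ cong₂ combine
                                               (Injection.injective (↔⇒↣ Fin.2↔Bool) (same zero))
                                               (bits-injective n (same ∘ suc)) ⟩
  uncurry combine (remQuot {2} (2 ^ n) j) ≡⟨ Fin.combine-remQuot {2} (2 ^ n) j ⟩
  j                                       ∎
  where open ≡-Reasoning

growthAtMost-mono : {X I : Set} {A : I → X → Bool} {m N N′ : ℕ} →
                    N ≤ N′ → GrowthAtMost A m N → GrowthAtMost A m N′
growthAtMost-mono N≤N′ growth f f-inj L g distinct = ≤-trans (growth f f-inj L g distinct) N≤N′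

shatters⇒2^n≤growth : {X I : Set} (A : I → X → Bool) {n N : ℕ} → GrowthAtMost A n N →
  (f : Fin n → X) → Injective _≡_ _≡_ f → Shatters A f → 2 ^ n ≤ N
shatters⇒2^n≤growth A {n} growth f f-inj sh = growth f f-inj (2 ^ n) (proj₁ ∘ sh ∘ bits n) distinct
  where
  distinct : DistinctTraces A f (proj₁ ∘ sh ∘ bits n)
  distinct a b a≢b same = a≢b (bits-injective n λ t →
    trans (sym (proj₂ (sh (bits n a)) t)) (trans (same t) (proj₂ (sh (bits n b)) t)))

flatten : {X : Set} {m k : ℕ} → (Fin m → Fin k → X) → Fin (m * k) → X
flatten {m = m} {k} f = uncurry f ∘ remQuot {m} k

anyFin-cong : ∀ k {b c : Fin k → Bool} → (∀ j → b j ≡ c j) → anyFin k b ≡ anyFin k c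
anyFin-cong zero    _  = refl
anyFin-cong (suc k) eq = cong₂ _∨_ (eq zero) (anyFin-cong k (eq ∘ suc))

Kfold-distinct⇒flatten-distinct : {X I : Set} (A : I → X → Bool) {k m : ℕ} (f : Fin m → Fin k → X)
  {L : ℕ} (g : Fin L → I) → DistinctTraces (Kfold A k) f g → DistinctTraces A (flatten f) g
Kfold-distinct⇒flatten-distinct A {k} {m} f g distinct a b a≢b same =
  distinct a b a≢b λ t → anyFin-cong k λ j →
    subst (λ x → A (g a) x ≡ A (g b) x) (cong (uncurry f) (Fin.remQuot-combine t j)) (same (combine t j))

module _ {X I : Set} (A : I → X → Bool) {ν : ℕ}
         (noShattered : (f : Fin (suc ν) → X) → Injective _≡_ _≡_ f → ¬ Shatters A f) where

  -- The points of h need not be distinct.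
  distinctTraces≤Φ : ∀ {N} (h : Fin N → X) {L} (g : Fin L → I) →
                     DistinctTraces A h g → L ≤ Φ N (suc ν)
  distinctTraces≤Φ {N} h {L} g distinct =
    ≤-trans (injection⇒≤count N IsTrace trace trace-isTrace trace-injective)
            (count≤Φ N (suc ν) IsTrace noShatteredPositions)
    where
    trace : Fin L → Vec Bool N
    trace a = tabulate (A (g a) ∘ h)

    trace-lookup : ∀ a t → lookup (trace a) t ≡ A (g a) (h t)
    trace-lookup a = Vec.lookup∘tabulate (A (g a) ∘ h)

    IsTrace : Vec Bool N → Bool
    IsTrace v = does (Fin.any? λ a → Vec.≡-dec Bool._≟_ (trace a) v)

    trace-isTrace : ∀ a → IsTrace (trace a) ≡ true
    trace-isTrace a = dec-true (Fin.any? _) (a , refl)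

    trace-injective : Injective _≡_ _≡_ trace
    trace-injective {a} {b} eq with a Fin.≟ b
    ... | yes a≡b = a≡b
    ... | no  a≢b = contradiction (λ t →
      trans (sym (trace-lookup a t)) (trans (cong (λ v → lookup v t) eq) (trace-lookup b t)))
      (distinct a b a≢b)

    noShatteredPositions : ShattersNo (suc ν) IsTrace
    noShatteredPositions e _ sh = noShattered (h ∘ e) (shatters⇒injective A (h ∘ e) shatters) shatters
      where
      shatters : Shatters A (h ∘ e)
      shatters s with sh s
      ... | v , isTrace , agree with Fin.any? (λ a → Vec.≡-dec Bool._≟_ (trace a) v) | isTrace
      ...   | yes (a , refl) | _  = g a , λ t → trans (sym (trace-lookup a (e t))) (agree t)
      ...   | no _           | ()

  Kfold-growth : ∀ k m → GrowthAtMost (Kfold A k) m (Φ (m * k) (suc ν))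
  Kfold-growth k m f _ L g distinct =
    distinctTraces≤Φ (flatten f) g (Kfold-distinct⇒flatten-distinct A f g distinct)

^-distribʳ-* : ∀ m n o → (m * n) ^ o ≡ m ^ o * n ^ o
^-distribʳ-* m n zero    = refl
^-distribʳ-* m n (suc o) =
  trans (cong ((m * n) *_) (^-distribʳ-* m n o)) (*-interchange m n (m ^ o) (n ^ o))

^-cancelʳ-≤ : ∀ m {n o} → 1 < m → m ^ n ≤ m ^ o → n ≤ o
^-cancelʳ-≤ m 1<m mⁿ≤mᵒ = ≮⇒≥ λ o<n → <⇒≱ (^-monoʳ-< m 1<m o<n) mⁿ≤mᵒ

n≤2^⌈log₂n⌉ : ∀ n → n ≤ 2 ^ ⌈log₂ n ⌉
n≤2^⌈log₂n⌉ n = go n (<-wellFounded n)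
  where
  go : ∀ n (rec : Acc _<_ n) → n ≤ 2 ^ ⌈log2⌉ n rec
  go zero          _        = z≤n
  go (suc zero)    _        = ≤-refl
  go (suc (suc n)) (acc rs) = begin
    2 + n                     ≤⟨ +-monoʳ-≤ 2 (n≤⌈n/2⌉+⌈n/2⌉) ⟩
    2 + (⌈ n /2⌉ + ⌈ n /2⌉)   ≡⟨ cong suc (+-suc ⌈ n /2⌉ ⌈ n /2⌉) ⟨
    suc ⌈ n /2⌉ + suc ⌈ n /2⌉ ≤⟨ +-mono-≤ ih (≤-trans ih (≤-reflexive (sym (+-identityʳ _)))) ⟩
    2 ^ r + (2 ^ r + 0)       ∎
    where
    open ≤-Reasoning
    r = ⌈log2⌉ (suc ⌈ n /2⌉) (rs (⌈n/2⌉<n n))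
    ih = go (suc ⌈ n /2⌉) (rs (⌈n/2⌉<n n))
    n≤⌈n/2⌉+⌈n/2⌉ : n ≤ ⌈ n /2⌉ + ⌈ n /2⌉
    n≤⌈n/2⌉+⌈n/2⌉ = ≤-trans (≤-reflexive (sym (⌊n/2⌋+⌈n/2⌉≡n n))) (+-monoˡ-≤ ⌈ n /2⌉ (⌊n/2⌋≤⌈n/2⌉ n))

1≤⌈log₂k⌉ : ∀ {k} → 2 ≤ k → 1 ≤ ⌈log₂ k ⌉
1≤⌈log₂k⌉ = ⌈log₂⌉-mono-≤

2+L≤3L : ∀ {L} → 1 ≤ L → 2 + L ≤ 3 * L
2+L≤3L {L} 1≤L = ≤-trans (+-monoˡ-≤ L (*-monoʳ-≤ 2 1≤L)) (≤-reflexive (2L+L≡3L L))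
  where
  2L+L≡3L : ∀ L → 2 * L + L ≡ 3 * L
  2L+L≡3L = solve-∀

Φ≤[1+n]^d : ∀ n d → Φ n (suc d) ≤ suc n ^ d
Φ≤[1+n]^d zero    d       = m^n>0 1 d
Φ≤[1+n]^d (suc n) zero    = ≤-trans (≤-reflexive (+-identityʳ (Φ n 1))) (Φ≤[1+n]^d n 0)
Φ≤[1+n]^d (suc n) (suc d) = begin
  Φ n (suc (suc d)) + Φ n (suc d) ≤⟨ +-mono-≤ (Φ≤[1+n]^d n (suc d)) (Φ≤[1+n]^d n d) ⟩
  suc n * suc n ^ d + suc n ^ d   ≡⟨ +-comm (suc n * suc n ^ d) _ ⟩
  suc (suc n) * suc n ^ d         ≤⟨ *-monoʳ-≤ (suc (suc n)) (^-monoˡ-≤ d (n≤1+n (suc n))) ⟩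
  suc (suc n) * suc (suc n) ^ d   ∎
  where open ≤-Reasoning

-- With T = 1 + t: T^n Φ(n, d + 1) = Σ_{i ≤ d} C(n, i) T^n ≤ T^d Σ_i C(n, i) T^(n-i) = T^d (T + 1)^n.
Φ-weighted : ∀ t n d → suc t ^ n * Φ n (suc d) ≤ suc t ^ d * suc (suc t) ^ n
Φ-weighted t zero    d       = *-monoˡ-≤ 1 (m^n>0 (suc t) d)
Φ-weighted t (suc n) zero    = begin
  (suc t * suc t ^ n) * (Φ n 1 + 0)   ≡⟨ cong ((suc t * suc t ^ n) *_) (+-identityʳ (Φ n 1)) ⟩
  (suc t * suc t ^ n) * Φ n 1         ≡⟨ *-assoc (suc t) (suc t ^ n) (Φ n 1) ⟩
  suc t * (suc t ^ n * Φ n 1)         ≤⟨ *-mono-≤ (n≤1+n (suc t)) (Φ-weighted t n 0) ⟩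
  suc (suc t) * (1 * suc (suc t) ^ n) ≡⟨ cong (suc (suc t) *_) (*-identityˡ (suc (suc t) ^ n)) ⟩
  suc (suc t) * suc (suc t) ^ n       ≡⟨ *-identityˡ _ ⟨
  1 * suc (suc t) ^ suc n             ∎
  where open ≤-Reasoning
Φ-weighted t (suc n) (suc d) = begin
  (T * T ^ n) * (Φ n (2 + d) + Φ n (1 + d))         ≡⟨ distrib T (T ^ n) (Φ n (2 + d)) (Φ n (1 + d)) ⟩
  T * (T ^ n * Φ n (2 + d)) + T * (T ^ n * Φ n (1 + d))
    ≤⟨ +-mono-≤ (*-monoʳ-≤ T (Φ-weighted t n (suc d))) (*-monoʳ-≤ T (Φ-weighted t n d)) ⟩
  T * ((T * T ^ d) * U) + T * (T ^ d * U)          ≡⟨ collect T (T ^ d) U ⟩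
  (T * T ^ d) * (U + T * U)                         ∎
  where
  open ≤-Reasoning
  T = suc t
  U = suc (suc t) ^ n
  distrib : ∀ T P a b → (T * P) * (a + b) ≡ T * (P * a) + T * (P * b)
  distrib = solve-∀
  collect : ∀ T P U → T * ((T * P) * U) + T * (P * U) ≡ (T * P) * (U + T * U)
  collect = solve-∀

-- (1 + 1/a)^j ≤ a/(a - j), cleared of denominators.
[1+a]^j*d≤a^[1+j] : ∀ a j d → a ≡ j + d → suc a ^ j * d ≤ a ^ suc j
[1+a]^j*d≤a^[1+j] a zero    d a≡d = ≤-reflexive (trans (+-identityʳ d) (trans (sym a≡d) (sym (*-identityʳ a))))
[1+a]^j*d≤a^[1+j] a (suc j) d a≡1+j+d = begin
  (suc a * S) * d ≡⟨ shift a S d ⟩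
  S * (suc a * d) ≤⟨ *-monoʳ-≤ S (≤-trans (+-monoˡ-≤ (a * d) d≤a) (≤-reflexive (sym (*-suc a d)))) ⟩
  S * (a * suc d) ≡⟨ swap a S d ⟩
  a * (S * suc d) ≤⟨ *-monoʳ-≤ a ([1+a]^j*d≤a^[1+j] a j (suc d) (trans a≡1+j+d (sym (+-suc j d)))) ⟩
  a * a ^ suc j   ∎
  where
  open ≤-Reasoning
  S = suc a ^ j
  d≤a : d ≤ a
  d≤a = ≤-trans (m≤n+m d (suc j)) (≤-reflexive (sym a≡1+j+d))
  shift : ∀ a S d → ((1 + a) * S) * d ≡ S * ((1 + a) * d)
  shift = solve-∀
  swap : ∀ a S d → S * (a * (1 + d)) ≡ a * (S * (1 + d))
  swap = solve-∀

3*[1+4k]^k≤4*[4k]^k : ∀ k .{{_ : NonZero k}} → 3 * suc (4 * k) ^ k ≤ 4 * (4 * k) ^ k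
3*[1+4k]^k≤4*[4k]^k k = *-cancelʳ-≤ (3 * suc (4 * k) ^ k) (4 * (4 * k) ^ k) k
  (subst₂ _≤_ (lhs (suc (4 * k) ^ k) k) (rhs ((4 * k) ^ k) k)
              ([1+a]^j*d≤a^[1+j] (4 * k) k (3 * k) refl))
  where
  lhs : ∀ u k → u * (3 * k) ≡ 3 * u * k
  lhs = solve-∀
  rhs : ∀ w k → 4 * k * w ≡ 4 * w * k
  rhs = solve-∀

Φ[n*k]*3^n≤[4k]^ν*4^n : ∀ n k ν .{{_ : NonZero k}} → Φ (n * k) (suc ν) * 3 ^ n ≤ (4 * k) ^ ν * 4 ^ n
Φ[n*k]*3^n≤[4k]^ν*4^n n k@(suc _) ν = *-cancelˡ-≤ (w ^ n) {{m^n≢0 w n {{m^n≢0 T k}}}} (begin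
  w ^ n * (Φ N (suc ν) * 3 ^ n)     ≡⟨ *-assoc (w ^ n) _ _ ⟨
  (w ^ n * Φ N (suc ν)) * 3 ^ n     ≡⟨ cong (λ x → x * Φ N (suc ν) * 3 ^ n) (pow-split T) ⟨
  (T ^ N * Φ N (suc ν)) * 3 ^ n     ≤⟨ *-monoˡ-≤ (3 ^ n) (Φ-weighted (pred T) N ν) ⟩
  (T ^ ν * suc T ^ N) * 3 ^ n       ≡⟨ cong (λ x → T ^ ν * x * 3 ^ n) (pow-split (suc T)) ⟩
  (T ^ ν * u ^ n) * 3 ^ n           ≡⟨ regroup (T ^ ν) (u ^ n) (3 ^ n) ⟩
  T ^ ν * (3 ^ n * u ^ n)           ≡⟨ cong (T ^ ν *_) (^-distribʳ-* 3 u n) ⟨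
  T ^ ν * (3 * u) ^ n               ≤⟨ *-monoʳ-≤ (T ^ ν) (^-monoˡ-≤ n (3*[1+4k]^k≤4*[4k]^k k)) ⟩
  T ^ ν * (4 * w) ^ n               ≡⟨ cong (T ^ ν *_) (^-distribʳ-* 4 w n) ⟩
  T ^ ν * (4 ^ n * w ^ n)           ≡⟨ rotate (T ^ ν) (4 ^ n) (w ^ n) ⟩
  w ^ n * (T ^ ν * 4 ^ n)           ∎)
  where
  open ≤-Reasoning
  N = n * k
  T = 4 * k
  w = T ^ k
  u = suc T ^ k
  pow-split : ∀ a → a ^ N ≡ (a ^ k) ^ n
  pow-split a = trans (cong (a ^_) (*-comm n k)) (sym (^-*-assoc a k n))
  regroup : ∀ x y z → (x * y) * z ≡ x * (z * y)
  regroup = solve-∀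
  rotate : ∀ x y z → x * (y * z) ≡ z * (x * y)
  rotate = solve-∀

3^n≤2^x*2^n⇒n≤2x : ∀ n x → 3 ^ n ≤ 2 ^ x * 2 ^ n → n ≤ 2 * x
3^n≤2^x*2^n⇒n≤2x n x 3ⁿ≤ = ^-cancelʳ-≤ 2 ≤-refl (subst (2 ^ n ≤_) (^-*-assoc 2 2 x)
  (*-cancelʳ-≤ (2 ^ n) (4 ^ x) (4 ^ n) {{m^n≢0 4 n}} (begin
    2 ^ n * 4 ^ n                       ≡⟨ ^-distribʳ-* 2 4 n ⟨
    8 ^ n                               ≤⟨ ^-monoˡ-≤ n (n≤1+n 8) ⟩
    9 ^ n                               ≡⟨ ^-distribʳ-* 3 3 n ⟩
    3 ^ n * 3 ^ n                       ≤⟨ *-mono-≤ 3ⁿ≤ 3ⁿ≤ ⟩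
    (2 ^ x * 2 ^ n) * (2 ^ x * 2 ^ n)   ≡⟨ *-interchange (2 ^ x) (2 ^ n) _ _ ⟩
    (2 ^ x * 2 ^ x) * (2 ^ n * 2 ^ n)   ≡⟨ cong₂ _*_ (^-distribʳ-* 2 2 x) (^-distribʳ-* 2 2 n) ⟨
    4 ^ x * 4 ^ n                       ∎)))
  where open ≤-Reasoning

1+m*k≤m^[2+⌈log₂k⌉] : ∀ m k → 2 ≤ m → suc (m * k) ≤ m ^ (2 + ⌈log₂ k ⌉)
1+m*k≤m^[2+⌈log₂k⌉] zero k ()
1+m*k≤m^[2+⌈log₂k⌉] m@(suc _) k 2≤m = begin
  suc (m * k)         ≤⟨ s≤s (*-monoʳ-≤ m (≤-trans (n≤2^⌈log₂n⌉ k) (^-monoˡ-≤ L 2≤m))) ⟩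
  suc y               ≤⟨ +-monoˡ-≤ y (m^n>0 m (suc L)) ⟩
  y + y               ≡⟨ cong (y +_) (+-identityʳ y) ⟨
  2 * y               ≤⟨ *-monoˡ-≤ y 2≤m ⟩
  m * y               ∎
  where
  open ≤-Reasoning
  L = ⌈log₂ k ⌉
  y = m * m ^ L

Φ[m*k]≤m^[6νL] : ∀ m k ν → 2 ≤ m → 2 ≤ k → Φ (m * k) (suc ν) ≤ m ^ (6 * ν * ⌈log₂ k ⌉)
Φ[m*k]≤m^[6νL] zero k ν () _
Φ[m*k]≤m^[6νL] m@(suc _) k ν 2≤m 2≤k = begin
  Φ (m * k) (suc ν)   ≤⟨ Φ≤[1+n]^d (m * k) ν ⟩
  suc (m * k) ^ ν     ≤⟨ ^-monoˡ-≤ ν (≤-trans (1+m*k≤m^[2+⌈log₂k⌉] m k 2≤m) (^-monoʳ-≤ m 2+L≤6L)) ⟩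
  (m ^ (6 * L)) ^ ν   ≡⟨ ^-*-assoc m (6 * L) ν ⟩
  m ^ (6 * L * ν)     ≡⟨ cong (m ^_) (reorder L ν) ⟩
  m ^ (6 * ν * L)     ∎
  where
  open ≤-Reasoning
  L = ⌈log₂ k ⌉
  2+L≤6L : 2 + L ≤ 6 * L
  2+L≤6L = ≤-trans (2+L≤3L (1≤⌈log₂k⌉ 2≤k)) (*-monoˡ-≤ L (m≤m+n 3 3))
  reorder : ∀ L ν → 6 * L * ν ≡ 6 * ν * L
  reorder = solve-∀

2^n≤Φ[n*k]⇒n≤6νL : ∀ n k ν → 2 ≤ k → 2 ^ n ≤ Φ (n * k) (suc ν) → n ≤ 6 * ν * ⌈log₂ k ⌉
2^n≤Φ[n*k]⇒n≤6νL n zero ν () _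
2^n≤Φ[n*k]⇒n≤6νL n k@(suc _) ν 2≤k 2ⁿ≤Φ = ≤-trans (3^n≤2^x*2^n⇒n≤2x n ((2 + L) * ν) 3ⁿ≤) 2[2+L]ν≤6νL
  where
  open ≤-Reasoning
  L = ⌈log₂ k ⌉
  4k≤2^[2+L] : 4 * k ≤ 2 ^ (2 + L)
  4k≤2^[2+L] = ≤-trans (*-monoʳ-≤ 4 (n≤2^⌈log₂n⌉ k)) (≤-reflexive (4x≡2[2x] (2 ^ L)))
    where
    4x≡2[2x] : ∀ x → 4 * x ≡ 2 * (2 * x)
    4x≡2[2x] = solve-∀
  3ⁿ≤ : 3 ^ n ≤ 2 ^ ((2 + L) * ν) * 2 ^ n
  3ⁿ≤ = *-cancelˡ-≤ (2 ^ n) {{m^n≢0 2 n}} (begin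
    2 ^ n * 3 ^ n                          ≤⟨ *-monoˡ-≤ (3 ^ n) 2ⁿ≤Φ ⟩
    Φ (n * k) (suc ν) * 3 ^ n              ≤⟨ Φ[n*k]*3^n≤[4k]^ν*4^n n k ν ⟩
    (4 * k) ^ ν * 4 ^ n                    ≤⟨ *-monoˡ-≤ (4 ^ n) (^-monoˡ-≤ ν 4k≤2^[2+L]) ⟩
    (2 ^ (2 + L)) ^ ν * 4 ^ n              ≡⟨ cong₂ _*_ (^-*-assoc 2 (2 + L) ν) (^-distribʳ-* 2 2 n) ⟩
    2 ^ ((2 + L) * ν) * (2 ^ n * 2 ^ n)    ≡⟨ rotate (2 ^ ((2 + L) * ν)) (2 ^ n) ⟩
    2 ^ n * (2 ^ ((2 + L) * ν) * 2 ^ n)    ∎)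
    where
    rotate : ∀ x y → x * (y * y) ≡ y * (x * y)
    rotate = solve-∀
  2[2+L]ν≤6νL : 2 * ((2 + L) * ν) ≤ 6 * ν * L
  2[2+L]ν≤6νL = ≤-trans (*-monoʳ-≤ 2 (*-monoˡ-≤ ν (2+L≤3L (1≤⌈log₂k⌉ 2≤k)))) (≤-reflexive (reorder L ν))
    where
    reorder : ∀ L ν → 2 * (3 * L * ν) ≡ 6 * ν * L
    reorder = solve-∀

mainTheorem3 : ∃ λ (C : ℕ) →
    (X I : Set) (A : I → X → Bool) (ν k : ℕ) → 2 ≤ k → VCdim A ν →
    ((m : ℕ) → 2 ≤ m → GrowthAtMost (Kfold A k) m (m ^ (C * ν * ⌈log₂ k ⌉)))
    × VCdimAtMost (Kfold A k) (C * ν * ⌈log₂ k ⌉)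
mainTheorem3 = 6 , λ X I A ν k 2≤k (_ , noShattered) →
  let Kfold-growth′ = Kfold-growth A noShattered k in
  (λ m 2≤m → growthAtMost-mono {A = Kfold A k} (Φ[m*k]≤m^[6νL] m k ν 2≤m 2≤k) (Kfold-growth′ m)) ,
  (λ n f f-inj shattered → 2^n≤Φ[n*k]⇒n≤6νL n k ν 2≤k
     (shatters⇒2^n≤growth (Kfold A k) (Kfold-growth′ n) f f-inj shattered))
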